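{- Let $\mu$ be a positive integer and let $G$ and $H$ be $\mu$-simultaneous edge colorable graphs. Then the Cartesian product $G\square H$ is $\mu$-simultaneous edge colorable, and $\chi'_{\mu\text{ - }SE}(G\square H)\le\chi'_{\mu\text{ - }SE}(G)+\chi'_{\mu\text{ - }SE}(H)$.
   Context: All graphs are finite and simple; $[l]=\{1,\ldots,l\}$. A $\mu$-simultaneous edge coloring of a graph $G$ is a $\mu$-tuple $(c_1,\ldots,c_\mu)$ of proper edge colorings $c_i:E(G)\to[l]$ (with a common color set $[l]$) such that (1) for every vertex $v$, the set $\{c_i(e): e \text{ incident to } v\}$ is the same for all $i$, and (2) $c_i(e)\neq c_j(e)$ for every edge $e$ and all $i\neq j$. $G$ is $\mu$-simultaneous edge colorable if such a coloring exists for some $l$, and $\chi'_{\mu\text{ - }SE}(G)$ is the minimum such $l$. The Cartesian product $G\square H$ has vertex set $V(G)\times V(H)$, with $(u,v)$ adjacent to $(u',v')$ iff either $u=u'$ and $vv'\in E(H)$, or $uu'\in E(G)$ and $v=v'$. -}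

module Defs where

open import Data.Nat using (ℕ; suc; _*_)
open import Data.Fin using (Fin; remQuot; _≟_)
open import Data.Bool using (Bool; T; _∧_; _∨_; not; true; false)
open import Data.Empty using (⊥-elim)
open import Relation.Nullary using (yes; no)
open import Data.Product using (Σ; ∃; _×_; _,_; proj₁; proj₂)
open import Relation.Binary.PropositionalEquality using (_≡_; _≢_; refl) renaming (sym to ≡-sym)
open import Relation.Nullary using (¬_)
open import Relation.Nullary.Decidable using (⌊_⌋)
open import Function.Bundles using (_⇔_)

record Graph : Set where
  field
    n      : ℕ
    adj    : Fin n → Fin n → Bool
    sym    : ∀ u v → adj u v ≡ adj v u
    irrefl : ∀ u → adj u u ≡ false
  Adj : Fin n → Fin n → Set
  Adj u v = T (adj u v)
open Graph public

_==_ : ∀ {k} → Fin k → Fin k → Bool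
x == y = ⌊ x ≟ y ⌋

-- Cartesian product G □ H, with vertex set Fin (n G * n H) identified with
-- Fin (n G) × Fin (n H) via remQuot.
pAdj : (G H : Graph) → Fin (n G) × Fin (n H) → Fin (n G) × Fin (n H) → Bool
pAdj G H (u , v) (u' , v') = ((u == u') ∧ adj H v v') ∨ (adj G u u' ∧ (v == v'))

□-adj : (G H : Graph) → Fin (n G * n H) → Fin (n G * n H) → Bool
□-adj G H x y = pAdj G H (remQuot (n H) x) (remQuot (n H) y)

==-sym : ∀ {k} (x y : Fin k) → (x == y) ≡ (y == x)
==-sym x y with x ≟ y | y ≟ x
... | yes _ | yes _ = refl
... | no _  | no _  = refl
... | yes e | no ne = ⊥-elim (ne (≡-sym e))
... | no ne | yes e = ⊥-elim (ne (≡-sym e))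

==-refl : ∀ {k} (x : Fin k) → (x == x) ≡ true
==-refl x with x ≟ x
... | yes _ = refl
... | no ne = ⊥-elim (ne refl)

pAdj-sym : (G H : Graph) → ∀ p q → pAdj G H p q ≡ pAdj G H q p
pAdj-sym G H (u , v) (u' , v')
  rewrite ==-sym u u' | sym H v v' | sym G u u' | ==-sym v v' = refl

pAdj-irrefl : (G H : Graph) → ∀ p → pAdj G H p p ≡ false
pAdj-irrefl G H (u , v) rewrite ==-refl u | irrefl H v | irrefl G u = refl

□-sym : (G H : Graph) → ∀ x y → □-adj G H x y ≡ □-adj G H y x
□-sym G H x y = pAdj-sym G H (remQuot (n H) x) (remQuot (n H) y)

□-irrefl : (G H : Graph) → ∀ x → □-adj G H x x ≡ false
□-irrefl G H x = pAdj-irrefl G H (remQuot (n H) x)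

_□_ : Graph → Graph → Graph
G □ H = record { n = n G * n H ; adj = □-adj G H
               ; sym = □-sym G H ; irrefl = □-irrefl G H }

-- An edge colouring of G with colour set [l] (represented as Fin l): a
-- colour for every ordered adjacent pair, symmetric (so it is a function
-- of the edge {u,v}) and proper (edges sharing an endpoint get distinct
-- colours).
record EdgeColoring (G : Graph) (l : ℕ) : Set where
  field
    col    : (u v : Fin (n G)) → Adj G u v → Fin l
    symm   : ∀ u v (p : Adj G u v) (q : Adj G v u) → col u v p ≡ col v u q
    proper : ∀ u v w (p : Adj G u v) (q : Adj G u w) →
             v ≢ w → col u v p ≢ col u w q
open EdgeColoring public

AtVertex : ∀ {G l} → EdgeColoring G l → Fin (n G) → Fin l → Set
AtVertex {G} c u k = Σ (Fin (n G)) λ v → Σ (Adj G u v) λ p → col c u v p ≡ k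

record SimulColoring (μ : ℕ) (G : Graph) (l : ℕ) : Set where
  field
    cs       : Fin μ → EdgeColoring G l
    sameSets : ∀ (i j : Fin μ) u k → AtVertex (cs i) u k ⇔ AtVertex (cs j) u k
    distinct : ∀ (i j : Fin μ) → i ≢ j → ∀ u v (p : Adj G u v) →
               col (cs i) u v p ≢ col (cs j) u v p

SEColorable : ℕ → Graph → Set
SEColorable μ G = Σ ℕ λ l → SimulColoring μ G l

open import Data.Nat using (_≤_)

IsChiSE : ℕ → Graph → ℕ → Set
IsChiSE μ G l = SimulColoring μ G l × (∀ l' → SimulColoring μ G l' → l ≤ l')

-- Colour the edges of G □ H of the form (u,v)(u',v) by the G-colouring c_i
-- of uu' with colours from the first block of a colours, and the edges
-- (u,v)(u,v') by the H-colouring d_i of vv' shifted into the second block of b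
-- colours. Properness and the pointwise distinctness of the i-th colourings
-- are inherited from the factors, and the colours seen at (u,v) are those of
-- c_i at u together with the shifted colours of d_i at v, which do not depend
-- on i. This gives a μ-simultaneous colouring of G □ H with a + b colours,
-- and the bound on χ' follows by minimality.
module Submission where

open import Defs hiding (sym)
open import Data.Nat using (ℕ; _≤_; _+_; _*_; _>_)
open import Data.Product using (Σ; _×_; _,_; proj₁; proj₂; uncurry)
open import Data.Fin using (Fin; _↑ˡ_; _↑ʳ_; splitAt; remQuot; combine; _≟_)
open import Data.Fin.Properties
  using (↑ˡ-injective; ↑ʳ-injective; splitAt-↑ˡ; splitAt-↑ʳ; remQuot-combine; combine-remQuot)
open import Data.Sum using (inj₁; inj₂)
open import Data.Bool using (T; _∧_)
open import Data.Bool.Properties using (T-∧; T-∨; T-irrelevant)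
open import Data.Empty using (⊥-elim)
open import Relation.Nullary using (¬_; yes; no)
open import Relation.Nullary.Decidable using (toWitness; fromWitness)
open import Relation.Binary.PropositionalEquality
  using (_≡_; _≢_; refl; cong; subst; trans; sym; module ≡-Reasoning)
open import Function.Bundles using (mk⇔; Equivalence)

↑ˡ≢↑ʳ : ∀ {m n} (i : Fin m) (j : Fin n) → i ↑ˡ n ≢ m ↑ʳ j
↑ˡ≢↑ʳ {m} {n} i j eq
  with () ← trans (sym (splitAt-↑ˡ m i n)) (trans (cong (splitAt m) eq) (splitAt-↑ʳ m n j))

remQuot-injective : ∀ {m} n {i j : Fin (m * n)} → remQuot {m} n i ≡ remQuot n j → i ≡ j
remQuot-injective {m} n {i} {j} eq = begin
  i                                 ≡⟨ sym (combine-remQuot {m} n i) ⟩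
  uncurry combine (remQuot {m} n i) ≡⟨ cong (uncurry combine) eq ⟩
  uncurry combine (remQuot {m} n j) ≡⟨ combine-remQuot {m} n j ⟩
  j                                 ∎
  where open ≡-Reasoning

==⇒≡ : ∀ {k} {x y : Fin k} → T (x == y) → x ≡ y
==⇒≡ = toWitness

Adj-irrefl : (G : Graph) {u : Fin (n G)} → ¬ Adj G u u
Adj-irrefl G {u} = subst T (irrefl G u)

module _ {G : Graph} {l : ℕ} where

  col-irrelevant : (c : EdgeColoring G l) {u v : Fin (n G)} (p q : Adj G u v) →
                   col c u v p ≡ col c u v q
  col-irrelevant c {u} {v} p q = cong (col c u v) (T-irrelevant p q)

  col-injective : (c : EdgeColoring G l) {u v w : Fin (n G)} (p : Adj G u v) (q : Adj G u w) →
                  col c u v p ≡ col c u w q → v ≡ w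
  col-injective c {u} {v} {w} p q eq with v ≟ w
  ... | yes v≡w = v≡w
  ... | no v≢w  = ⊥-elim (proper c u v w p q v≢w eq)

  Differ : EdgeColoring G l → EdgeColoring G l → Set
  Differ c c' = ∀ u v (p : Adj G u v) → col c u v p ≢ col c' u v p

  _⊆ᶜ_ : EdgeColoring G l → EdgeColoring G l → Set
  c ⊆ᶜ c' = ∀ u k → AtVertex c u k → AtVertex c' u k

module _ {G H : Graph} where

  Vertex : Set
  Vertex = Fin (n G) × Fin (n H)

  pair : Fin (n (G □ H)) → Vertex
  pair = remQuot (n H)

  data Step : Vertex → Vertex → Set where
    alongH : ∀ {u v v'} → Adj H v v' → Step (u , v) (u , v')
    alongG : ∀ {u u' v} → Adj G u u' → Step (u , v) (u' , v)

  step : ∀ p q → T (pAdj G H p q) → Step p q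
  step (u , v) (u' , v') e with Equivalence.to (T-∨ {u == u' ∧ adj H v v'}) e
  ... | inj₁ uv with Equivalence.to (T-∧ {u == u'}) uv
  ...   | u≡u' , h with refl ← ==⇒≡ u≡u' = alongH h
  step (u , v) (u' , v') e | inj₂ uv with Equivalence.to (T-∧ {adj G u u'}) uv
  ...   | g , v≡v' with refl ← ==⇒≡ v≡v' = alongG g

  step-adj : ∀ {p q} → Step p q → T (pAdj G H p q)
  step-adj {u , v} {_ , v'} (alongH h) =
    Equivalence.from (T-∨ {u == u ∧ adj H v v'})
      (inj₁ (Equivalence.from (T-∧ {u == u}) (fromWitness refl , h)))
  step-adj {u , v} {u' , _} (alongG g) =
    Equivalence.from (T-∨ {u == u' ∧ adj H v v})
      (inj₂ (Equivalence.from (T-∧ {adj G u u'}) (g , fromWitness refl)))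

  module _ {a b : ℕ} where

    stepColour : EdgeColoring G a → EdgeColoring H b → ∀ {p q} → Step p q → Fin (a + b)
    stepColour cG cH (alongH {v = v} {v'} h) = a ↑ʳ col cH v v' h
    stepColour cG cH (alongG {u} {u'} g)     = col cG u u' g ↑ˡ b

    module _ (cG : EdgeColoring G a) (cH : EdgeColoring H b) where

      stepColour-cong : ∀ {p q q'} (s : Step p q) (t : Step p q') → q ≡ q' →
                        stepColour cG cH s ≡ stepColour cG cH t
      stepColour-cong (alongH h) (alongH h') refl = cong (a ↑ʳ_) (col-irrelevant cH h h')
      stepColour-cong (alongG g) (alongG g') refl = cong (_↑ˡ b) (col-irrelevant cG g g')
      stepColour-cong (alongH h) (alongG g)  refl = ⊥-elim (Adj-irrefl G g)
      stepColour-cong (alongG g) (alongH h)  refl = ⊥-elim (Adj-irrefl G g)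

      stepColour-sym : ∀ {p q} (s : Step p q) (t : Step q p) →
                       stepColour cG cH s ≡ stepColour cG cH t
      stepColour-sym (alongH h) (alongH h') = cong (a ↑ʳ_) (symm cH _ _ h h')
      stepColour-sym (alongG g) (alongG g') = cong (_↑ˡ b) (symm cG _ _ g g')
      stepColour-sym (alongH h) (alongG g)  = ⊥-elim (Adj-irrefl G g)
      stepColour-sym (alongG g) (alongH h)  = ⊥-elim (Adj-irrefl G g)

      stepColour-injective : ∀ {p q r} (s : Step p q) (t : Step p r) →
                             stepColour cG cH s ≡ stepColour cG cH t → q ≡ r
      stepColour-injective (alongH h) (alongH h') eq =
        cong (_ ,_) (col-injective cH h h' (↑ʳ-injective a _ _ eq))
      stepColour-injective (alongG g) (alongG g') eq =
        cong (_, _) (col-injective cG g g' (↑ˡ-injective b _ _ eq))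
      stepColour-injective (alongH h) (alongG g) eq = ⊥-elim (↑ˡ≢↑ʳ _ _ (sym eq))
      stepColour-injective (alongG g) (alongH h) eq = ⊥-elim (↑ˡ≢↑ʳ _ _ eq)

    _⊗_ : EdgeColoring G a → EdgeColoring H b → EdgeColoring (G □ H) (a + b)
    cG ⊗ cH = record
      { col    = λ x y e → stepColour cG cH (step (pair x) (pair y) e)
      ; symm   = λ x y e e' →
          stepColour-sym cG cH (step (pair x) (pair y) e) (step (pair y) (pair x) e')
      ; proper = λ x y z e e' y≢z eq →
          y≢z (remQuot-injective (n H)
                 (stepColour-injective cG cH (step (pair x) (pair y) e) (step (pair x) (pair z) e') eq))
      }

    ⊗-differ : {cG cG' : EdgeColoring G a} {cH cH' : EdgeColoring H b} →
               Differ cG cG' → Differ cH cH' → Differ (cG ⊗ cH) (cG' ⊗ cH')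
    ⊗-differ dG dH x y e = differ (step (pair x) (pair y) e)
      where
        differ : ∀ {p q} (s : Step p q) → stepColour _ _ s ≢ stepColour _ _ s
        differ (alongH h) eq = dH _ _ h (↑ʳ-injective a _ _ eq)
        differ (alongG g) eq = dG _ _ g (↑ˡ-injective b _ _ eq)

    step-atVertex : (cG : EdgeColoring G a) (cH : EdgeColoring H b) (x : Fin (n (G □ H))) →
                    ∀ {q} (t : Step (pair x) q) → AtVertex (cG ⊗ cH) x (stepColour cG cH t)
    step-atVertex cG cH x {q} t =
      y , e , stepColour-cong cG cH (step (pair x) (pair y) e) t pair-y
      where
        y : Fin (n (G □ H))
        y = uncurry combine q

        pair-y : pair y ≡ q
        pair-y = remQuot-combine (proj₁ q) (proj₂ q)

        e : T (pAdj G H (pair x) (pair y))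
        e = subst (λ r → T (pAdj G H (pair x) r)) (sym pair-y) (step-adj t)

    step-transfer : {cG cG' : EdgeColoring G a} {cH cH' : EdgeColoring H b} →
                    cG ⊆ᶜ cG' → cH ⊆ᶜ cH' → ∀ {p q} (s : Step p q) →
                    Σ Vertex λ q' → Σ (Step p q') λ t → stepColour cG' cH' t ≡ stepColour cG cH s
    step-transfer iG iH (alongH {u} {v} {v'} h) with v'' , h' , c≡ ← iH v _ (v' , h , refl) =
      (u , v'') , alongH h' , cong (a ↑ʳ_) c≡
    step-transfer iG iH (alongG {u} {u'} {v} g) with u'' , g' , c≡ ← iG u _ (u' , g , refl) =
      (u'' , v) , alongG g' , cong (_↑ˡ b) c≡

    ⊗-mono : {cG cG' : EdgeColoring G a} {cH cH' : EdgeColoring H b} →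
             cG ⊆ᶜ cG' → cH ⊆ᶜ cH' → (cG ⊗ cH) ⊆ᶜ (cG' ⊗ cH')
    ⊗-mono {cG' = cG'} {cH' = cH'} iG iH x k (y , e , eq)
      with _ , t , t≡s ← step-transfer iG iH (step (pair x) (pair y) e) =
      subst (AtVertex (cG' ⊗ cH') x) (trans t≡s eq) (step-atVertex cG' cH' x t)

_⊠_ : ∀ {μ G H a b} → SimulColoring μ G a → SimulColoring μ H b → SimulColoring μ (G □ H) (a + b)
SG ⊠ SH = record
  { cs       = λ i → cs SG i ⊗ cs SH i
  ; sameSets = λ i j x k →
      mk⇔ (⊗-mono (included SG i j) (included SH i j) x k)
          (⊗-mono (included SG j i) (included SH j i) x k)
  ; distinct = λ i j i≢j → ⊗-differ (distinct SG i j i≢j) (distinct SH i j i≢j)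
  }
  where
    open SimulColoring
    included : ∀ {μ G l} (S : SimulColoring μ G l) i j → cs S i ⊆ᶜ cs S j
    included S i j u k = Equivalence.to (sameSets S i j u k)

-- The construction works for every μ.
theorem2p14 : (μ : ℕ) → μ > 0 → (G H : Graph) →
    SEColorable μ G → SEColorable μ H →
    SEColorable μ (G □ H) ×
    (∀ a b c → IsChiSE μ G a → IsChiSE μ H b → IsChiSE μ (G □ H) c → c ≤ a + b)
theorem2p14 μ _ G H (a , SG) (b , SH) =
  (a + b , SG ⊠ SH) ,
  λ a' b' c (SG' , _) (SH' , _) (_ , minimal) → minimal (a' + b') (SG' ⊠ SH')
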